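{- Consider an instance of $P|d_j=d,n_i\leq N|X$ and let $\mathcal{H}=\{j: p_j\geq d\}$. If $|\mathcal{H}|\leq m-1$, then there exists a feasible schedule that is optimal both for maximizing the early work $X$ and for minimizing the late work $Y$ in which the jobs of $\mathcal{H}$ are scheduled on $|\mathcal{H}|$ distinct machines.
   Context: An instance consists of $m$ identical parallel machines, $n$ jobs with positive integer processing times $p_j$, a common due date $d$, and a machine capacity $N$ (a positive integer with $mN\geq n$). A feasible schedule assigns each job a machine and a start time such that jobs on the same machine do not overlap, there is no idle time between jobs on any machine, and each machine receives at most $N$ jobs. For a schedule with machine loads $P_i=\sum_{j\text{ on machine }i}p_j$, the early work is $X=\sum_{i=1}^m\min\{d,P_i\}$ and the late work is $Y=\sum_{i=1}^m\max\{0,P_i-d\}$. -}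

module Defs where

open import Data.Nat using (ℕ; _≤_; _<_; _⊓_; _∸_; _*_)
open import Data.Nat.Properties using (_≤?_)
open import Data.Fin using (Fin; _≟_)
open import Data.List using (List; map; filter; length; allFin)
open import Data.Nat.ListAction using (sum)
open import Data.Bool using (if_then_else_)
open import Relation.Nullary.Decidable using (⌊_⌋)
open import Relation.Binary.PropositionalEquality using (_≡_)

-- Since there is no idle time
-- and machines start at time 0, the early/late work depend only on the loads,
-- hence a schedule is represented by its job-to-machine assignment.
Assignment : ℕ → ℕ → Set
Assignment n m = Fin n → Fin m

load : ∀ {n m} → (Fin n → ℕ) → Assignment n m → Fin m → ℕ
load {n} p σ i = sum (map (λ j → if ⌊ σ j ≟ i ⌋ then p j else 0) (allFin n))

jobsOn : ∀ {n m} → Assignment n m → Fin m → ℕ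
jobsOn {n} σ i = sum (map (λ j → if ⌊ σ j ≟ i ⌋ then 1 else 0) (allFin n))

Feasible : ∀ {n m} → ℕ → Assignment n m → Set
Feasible {n} {m} N σ = (i : Fin m) → jobsOn σ i ≤ N

earlyWork : ∀ {n m} → (Fin n → ℕ) → ℕ → Assignment n m → ℕ
earlyWork {n} {m} p d σ = sum (map (λ i → d ⊓ load p σ i) (allFin m))

lateWork : ∀ {n m} → (Fin n → ℕ) → ℕ → Assignment n m → ℕ
lateWork {n} {m} p d σ = sum (map (λ i → load p σ i ∸ d) (allFin m))

bigJobs : ∀ {n} → (Fin n → ℕ) → ℕ → List (Fin n)
bigJobs {n} p d = filter (λ j → d ≤? p j) (allFin n)

-- Start from a feasible schedule of maximum early work, which exists as there are finitely
-- many schedules.  While two big jobs j and k share a machine, some machine i′ carries no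
-- big job, since |H| < m.  Move k to i′ and, if i′ is not empty, send one of its (small)
-- jobs back in exchange, so that no machine gains a job.  Both machines involved then carry
-- a big job, so their contribution to the early work is the maximal d: the early work does
-- not decrease while fewer big jobs share machines.  As X + Y is the total processing time
-- for every schedule, maximising X minimises Y.
module Submission where

open import Defs
open import Data.Bool using (if_then_else_)
open import Data.Fin using (Fin; zero; suc; _≟_; punchIn)
open import Data.Fin.Properties using (any?; all?; punchInᵢ≢i)
open import Data.List using (List; []; _∷_; map; filter; length; allFin; tabulate)
open import Data.List.Properties using (map-tabulate; map-cong)
import Data.Nat.ListAction as List
open import Data.Nat using (ℕ; zero; suc; _+_; _*_; _∸_; _⊓_; _≤_; _<_; z≤n)
open import Data.Nat.Properties hiding (_≟_)
open import Data.Product using (Σ; ∃; _×_; _,_)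
open import Data.Sum using (_⊎_; inj₁; inj₂)
open import Data.Vec.Functional using (updateAt; removeAt)
import Data.Vec.Functional as Vector
open import Data.Vec.Functional.Properties using (updateAt-updates; updateAt-minimal)
open import Function using (_∘_; id; const)
open import Data.Nat.Induction using (<-wellFounded)
open import Induction.WellFounded using (Acc; acc)
open import Relation.Binary.Definitions using (_Respects_)
open import Relation.Binary.PropositionalEquality
open import Relation.Nullary using (¬_; Dec; yes; no; contradiction)
open import Relation.Nullary.Decidable using (⌊_⌋; map′; _×-dec_; ¬?; decidable-stable)
open import Relation.Unary using (Pred; Decidable)
open import Algebra.Properties.CommutativeSemigroup +-commutativeSemigroup using (xy∙z≈zy∙x)
open import Algebra.Properties.CommutativeMonoid.Sum +-0-commutativeMonoid
  using (sum; sum-syntax; sum-cong-≗; sum-remove; sum-replicate-zero; ∑-comm; ∑-distrib-+)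

sum-allFin : ∀ {n} (f : Fin n → ℕ) → List.sum (map f (allFin n)) ≡ sum f
sum-allFin {n} f = trans (cong List.sum (map-tabulate id f)) (sum-tabulate n f)
  where
  sum-tabulate : ∀ n (f : Fin n → ℕ) → List.sum (tabulate f) ≡ sum f
  sum-tabulate zero    f = refl
  sum-tabulate (suc n) f = cong (f zero +_) (sum-tabulate n (f ∘ suc))

sum-const : ∀ n c → ∑[ i < n ] c ≡ n * c
sum-const zero    c = refl
sum-const (suc n) c = cong (c +_) (sum-const n c)

sum-zero : ∀ {n} {f : Fin n → ℕ} → (∀ i → f i ≡ 0) → sum f ≡ 0
sum-zero {n} f≡0 = trans (sum-cong-≗ f≡0) (sum-replicate-zero n)

sum-mono-≤ : ∀ {n} {f g : Fin n → ℕ} → (∀ i → f i ≤ g i) → sum f ≤ sum g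
sum-mono-≤ {zero}  _   = z≤n
sum-mono-≤ {suc n} f≤g = +-mono-≤ (f≤g zero) (sum-mono-≤ (f≤g ∘ suc))

sum-mono-< : ∀ {n} {f g : Fin n → ℕ} i → (∀ j → f j ≤ g j) → f i < g i → sum f < sum g
sum-mono-< {suc n} {f} {g} i f≤g fi<gi = begin-strict
  sum f                     ≡⟨ sum-remove f ⟩
  f i + sum (removeAt f i)  <⟨ +-mono-<-≤ fi<gi (sum-mono-≤ (f≤g ∘ punchIn i)) ⟩
  g i + sum (removeAt g i)  ≡⟨ sum-remove g ⟨
  sum g                     ∎
  where open ≤-Reasoning

≤-sum : ∀ {n} (f : Fin n → ℕ) i → f i ≤ sum f
≤-sum {suc n} f i = ≤-trans (m≤m+n (f i) _) (≤-reflexive (sym (sum-remove f)))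

sum-agree-off : ∀ {n} {f g : Fin n → ℕ} k → (∀ j → j ≢ k → f j ≡ g j) →
                sum f + g k ≡ sum g + f k
sum-agree-off {suc n} {f} {g} k f≡g = begin
  sum f + g k                     ≡⟨ cong (_+ g k) (sum-remove f) ⟩
  f k + sum (removeAt f k) + g k  ≡⟨ cong (λ s → f k + s + g k) (sum-cong-≗ off-k) ⟩
  f k + sum (removeAt g k) + g k  ≡⟨ xy∙z≈zy∙x (f k) _ (g k) ⟩
  g k + sum (removeAt g k) + f k  ≡⟨ cong (_+ f k) (sum-remove g) ⟨
  sum g + f k                     ∎
  where
  open ≡-Reasoning
  off-k : ∀ j → f (punchIn k j) ≡ g (punchIn k j)
  off-k j = f≡g (punchIn k j) (punchInᵢ≢i k j)

sum<n*c⇒∃f<c : ∀ {n} (f : Fin n → ℕ) {c} → sum f < n * c → ∃ λ i → f i < c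
sum<n*c⇒∃f<c {n} f {c} sum<n*c with any? (λ i → f i <? c)
... | yes found = found
... | no none = contradiction (sum-mono-≤ c≤f) (<⇒≱ (subst (sum f <_) (sym (sum-const n c)) sum<n*c))
  where
  c≤f : ∀ i → c ≤ f i
  c≤f i = ≮⇒≥ (λ fi<c → none (i , fi<c))

count-filter : ∀ {a p} {A : Set a} {P : Pred A p} (P? : Decidable P) (xs : List A) →
               List.sum (map (λ x → if ⌊ P? x ⌋ then 1 else 0) xs) ≡ length (filter P? xs)
count-filter P? []       = refl
count-filter P? (x ∷ xs) with P? x
... | yes _ = cong suc (count-filter P? xs)
... | no _  = count-filter P? xs

m≤o⇒m⊓n≤m⊓o : ∀ {m n o} → m ≤ o → m ⊓ n ≤ m ⊓ o
m≤o⇒m⊓n≤m⊓o {m} {n} m≤o = subst (m ⊓ n ≤_) (sym (m≤n⇒m⊓n≡m m≤o)) (m⊓n≤m m n)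

module _ {m : ℕ} where
  open ≡-Reasoning

  δ : Fin m → Fin m → ℕ → ℕ
  δ a i w = if ⌊ a ≟ i ⌋ then w else 0

  δ-≡ : ∀ {a i w} → a ≡ i → δ a i w ≡ w
  δ-≡ {a} {i} a≡i with a ≟ i
  ... | yes _   = refl
  ... | no a≢i = contradiction a≡i a≢i

  δ-≢ : ∀ {a i w} → a ≢ i → δ a i w ≡ 0
  δ-≢ {a} {i} a≢i with a ≟ i
  ... | yes a≡i = contradiction a≡i a≢i
  ... | no _    = refl

  δ-0 : ∀ a i → δ a i 0 ≡ 0
  δ-0 a i with a ≟ i
  ... | yes _ = refl
  ... | no _  = refl

  ∑-δ : ∀ a w → ∑[ i < m ] δ a i w ≡ w
  ∑-δ a w = begin
    ∑[ i < m ] δ a i w             ≡⟨ +-identityʳ _ ⟨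
    ∑[ i < m ] δ a i w + 0         ≡⟨ sum-agree-off {f = λ i → δ a i w} {g = λ _ → 0} a off-a ⟩
    ∑[ i < m ] 0 + δ a a w         ≡⟨ cong₂ _+_ (sum-zero {m} (λ _ → refl)) (δ-≡ {a} refl) ⟩
    w                              ∎
    where
    off-a : ∀ i → i ≢ a → δ a i w ≡ 0
    off-a i i≢a = δ-≢ (i≢a ∘ sym)

  excess : (Fin m → ℕ) → ℕ
  excess f = ∑[ i < m ] (f i ∸ 1)

  excess-shift< : ∀ {f g : Fin m → ℕ} {i i′} → i ≢ i′ → f i′ ≡ 0 → 1 ≤ g i →
                  (∀ x → g x + δ i x 1 ≡ f x + δ i′ x 1) → excess g < excess f
  excess-shift< {f} {g} {i} {i′} i≢i′ fi′≡0 1≤gi shift = sum-mono-< i pointwise at-i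
    where
    shift-elsewhere : ∀ x → i ≢ x → i′ ≢ x → g x ≡ f x
    shift-elsewhere x i≢x i′≢x = +-cancelʳ-≡ 0 _ _ (begin
      g x + 0         ≡⟨ cong (g x +_) (δ-≢ i≢x) ⟨
      g x + δ i x 1   ≡⟨ shift x ⟩
      f x + δ i′ x 1  ≡⟨ cong (f x +_) (δ-≢ i′≢x) ⟩
      f x + 0         ∎)
    at-i : g i ∸ 1 < f i ∸ 1
    at-i = ∸-monoˡ-< (≤-reflexive (begin
      suc (g i)        ≡⟨ +-comm 1 (g i) ⟩
      g i + 1          ≡⟨ cong (g i +_) (δ-≡ refl) ⟨
      g i + δ i i 1    ≡⟨ shift i ⟩
      f i + δ i′ i 1   ≡⟨ cong (f i +_) (δ-≢ (i≢i′ ∘ sym)) ⟩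
      f i + 0          ≡⟨ +-identityʳ (f i) ⟩
      f i              ∎)) 1≤gi
    at-i′ : g i′ ≡ 1
    at-i′ = begin
      g i′                ≡⟨ +-identityʳ (g i′) ⟨
      g i′ + 0            ≡⟨ cong (g i′ +_) (δ-≢ i≢i′) ⟨
      g i′ + δ i i′ 1     ≡⟨ shift i′ ⟩
      f i′ + δ i′ i′ 1    ≡⟨ cong₂ _+_ fi′≡0 (δ-≡ refl) ⟩
      1                   ∎
    pointwise : ∀ x → g x ∸ 1 ≤ f x ∸ 1
    pointwise x with i ≟ x | i′ ≟ x
    ... | yes refl | _        = <⇒≤ at-i
    ... | no _     | yes refl = ≤-trans (≤-reflexive (cong (_∸ 1) at-i′)) z≤n
    ... | no i≢x   | no i′≢x  = ≤-reflexive (cong (_∸ 1) (shift-elsewhere x i≢x i′≢x))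

∃? : ∀ {ℓ n m} {P : Pred (Fin n → Fin m) ℓ} → P Respects _≗_ → Decidable P → Dec (∃ P)
∃? {n = zero} resp P? with P? (λ ())
... | yes p = yes (_ , p)
... | no ¬p = no (λ (f , pf) → ¬p (resp (λ ()) pf))
∃? {n = suc n} {P = P} resp P? =
  map′ (λ (a , g , p) → a Vector.∷ g , p)
       (λ (f , pf) → f zero , f ∘ suc , resp head∷tail pf)
       (any? λ a → ∃? (λ g≗h → resp (∷-cong a g≗h)) (P? ∘ (a Vector.∷_)))
  where
  head∷tail : ∀ {f : Fin (suc n) → _} → f ≗ (f zero Vector.∷ f ∘ suc)
  head∷tail zero    = refl
  head∷tail (suc j) = refl
  ∷-cong : ∀ {B : Set} (a : B) {g h : Fin n → B} → g ≗ h → (a Vector.∷ g) ≗ (a Vector.∷ h)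
  ∷-cong a g≗h zero    = refl
  ∷-cong a g≗h (suc j) = g≗h j

module _ {ℓ n m} {P : Pred (Fin n → Fin m) ℓ} (resp : P Respects _≗_) (P? : Decidable P)
         (v : (Fin n → Fin m) → ℕ) (v-cong : ∀ {f g} → f ≗ g → v f ≡ v g) where

  maximiser : ∀ B → (∀ f → P f → v f ≤ B) → ∃ P → ∃ λ f → P f × (∀ g → P g → v g ≤ v f)
  maximiser B bounded ∃P with ∃? {P = λ f → P f × B ≤ v f} attains-resp (λ f → P? f ×-dec B ≤? v f)
    where
    attains-resp : ∀ {f g} → f ≗ g → P f × B ≤ v f → P g × B ≤ v g
    attains-resp f≗g (pf , B≤vf) = resp f≗g pf , subst (B ≤_) (v-cong f≗g) B≤vf
  ... | yes (f , pf , B≤vf) = f , pf , λ g pg → ≤-trans (bounded g pg) B≤vf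
  maximiser zero    _       (f , pf) | no none = contradiction (f , pf , z≤n) none
  maximiser (suc B) bounded ∃P       | no none = maximiser B below-B ∃P
    where
    below-B : ∀ f → P f → v f ≤ B
    below-B f pf = m<1+n⇒m≤n (≰⇒> λ 1+B≤vf → none (f , pf , 1+B≤vf))

_[_]≔_ : ∀ {n m} → Assignment n m → Fin n → Fin m → Assignment n m
σ [ k ]≔ a = updateAt σ k (const a)

module _ {n m : ℕ} where

  load-∑ : ∀ (q : Fin n → ℕ) (σ : Assignment n m) i → load q σ i ≡ ∑[ j < n ] δ (σ j) i (q j)
  load-∑ q σ i = sum-allFin (λ j → δ (σ j) i (q j))

  load-cong : ∀ q {σ τ : Assignment n m} → σ ≗ τ → ∀ i → load q σ i ≡ load q τ i
  load-cong q {σ} {τ} σ≗τ i = begin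
    load q σ i                 ≡⟨ load-∑ q σ i ⟩
    ∑[ j < n ] δ (σ j) i (q j) ≡⟨ sum-cong-≗ (λ j → cong (λ a → δ a i (q j)) (σ≗τ j)) ⟩
    ∑[ j < n ] δ (τ j) i (q j) ≡⟨ load-∑ q τ i ⟨
    load q τ i                 ∎
    where open ≡-Reasoning

  ∑-load : ∀ q (σ : Assignment n m) → ∑[ i < m ] load q σ i ≡ ∑[ j < n ] q j
  ∑-load q σ = begin
    ∑[ i < m ] load q σ i                 ≡⟨ sum-cong-≗ (load-∑ q σ) ⟩
    ∑[ i < m ] ∑[ j < n ] δ (σ j) i (q j) ≡⟨ ∑-comm (λ i j → δ (σ j) i (q j)) ⟩
    ∑[ j < n ] ∑[ i < m ] δ (σ j) i (q j) ≡⟨ sum-cong-≗ (λ j → ∑-δ (σ j) (q j)) ⟩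
    ∑[ j < n ] q j                        ∎
    where open ≡-Reasoning

  weight≤load : ∀ q (σ : Assignment n m) {j i} → σ j ≡ i → q j ≤ load q σ i
  weight≤load q σ {j} {i} σj≡i = begin
    q j                        ≡⟨ δ-≡ σj≡i ⟨
    δ (σ j) i (q j)            ≤⟨ ≤-sum (λ j → δ (σ j) i (q j)) j ⟩
    ∑[ j < n ] δ (σ j) i (q j) ≡⟨ load-∑ q σ i ⟨
    load q σ i                 ∎
    where open ≤-Reasoning

  load-idle : ∀ q (σ : Assignment n m) {i} → (∀ j → σ j ≢ i) → load q σ i ≡ 0
  load-idle q σ {i} idle = trans (load-∑ q σ i) (sum-zero (λ j → δ-≢ (idle j)))

  load-reassign : ∀ q (σ : Assignment n m) k a i →
                  load q (σ [ k ]≔ a) i + δ (σ k) i (q k) ≡ load q σ i + δ a i (q k)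
  load-reassign q σ k a i = begin
    load q σ′ i + δ (σ k) i (q k)                ≡⟨ cong (_+ _) (load-∑ q σ′ i) ⟩
    ∑[ j < n ] δ (σ′ j) i (q j) + δ (σ k) i (q k) ≡⟨ sum-agree-off k unmoved ⟩
    ∑[ j < n ] δ (σ j) i (q j) + δ (σ′ k) i (q k) ≡⟨ cong₂ _+_ (load-∑ q σ i) moved ⟨
    load q σ i + δ a i (q k)                     ∎
    where
    open ≡-Reasoning
    σ′ = σ [ k ]≔ a
    unmoved : ∀ j → j ≢ k → δ (σ′ j) i (q j) ≡ δ (σ j) i (q j)
    unmoved j j≢k = cong (λ b → δ b i (q j)) (updateAt-minimal j k σ j≢k)
    moved : δ a i (q k) ≡ δ (σ′ k) i (q k)
    moved = cong (λ b → δ b i (q k)) (sym (updateAt-updates k σ))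

  load-reassign-elsewhere : ∀ q (σ : Assignment n m) k a {i} → σ k ≢ i → a ≢ i →
                            load q (σ [ k ]≔ a) i ≡ load q σ i
  load-reassign-elsewhere q σ k a {i} σk≢i a≢i = +-cancelʳ-≡ 0 _ _ (begin
    load′ + 0                    ≡⟨ cong (load′ +_) (δ-≢ σk≢i) ⟨
    load′ + δ (σ k) i (q k)      ≡⟨ load-reassign q σ k a i ⟩
    load q σ i + δ a i (q k)     ≡⟨ cong (load q σ i +_) (δ-≢ a≢i) ⟩
    load q σ i + 0               ∎)
    where
    open ≡-Reasoning
    load′ = load q (σ [ k ]≔ a) i

  load-reassign-weightless : ∀ q (σ : Assignment n m) k a i → q k ≡ 0 →
                             load q (σ [ k ]≔ a) i ≡ load q σ i
  load-reassign-weightless q σ k a i qk≡0 = +-cancelʳ-≡ 0 _ _ (begin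
    load′ + 0                    ≡⟨ cong (load′ +_) (δ-0 (σ k) i) ⟨
    load′ + δ (σ k) i 0          ≡⟨ cong (λ w → load′ + δ (σ k) i w) qk≡0 ⟨
    load′ + δ (σ k) i (q k)      ≡⟨ load-reassign q σ k a i ⟩
    load q σ i + δ a i (q k)     ≡⟨ cong (λ w → load q σ i + δ a i w) qk≡0 ⟩
    load q σ i + δ a i 0         ≡⟨ cong (load q σ i +_) (δ-0 a i) ⟩
    load q σ i + 0               ∎)
    where
    open ≡-Reasoning
    load′ = load q (σ [ k ]≔ a) i

  load-swap : ∀ q (σ : Assignment n m) {k s} → q k ≡ q s → s ≢ k → ∀ i →
              load q ((σ [ k ]≔ σ s) [ s ]≔ σ k) i ≡ load q σ i
  load-swap q σ {k} {s} qk≡qs s≢k i = +-cancelʳ-≡ (δ (σ s) i (q s)) _ _ (begin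
    load q σ″ i + δ (σ s) i (q s)   ≡⟨ cong (λ b → load q σ″ i + δ b i (q s)) σ′s≡σs ⟨
    load q σ″ i + δ (σ′ s) i (q s)  ≡⟨ load-reassign q σ′ s (σ k) i ⟩
    load q σ′ i + δ (σ k) i (q s)   ≡⟨ cong (λ w → load q σ′ i + δ (σ k) i w) qk≡qs ⟨
    load q σ′ i + δ (σ k) i (q k)   ≡⟨ load-reassign q σ k (σ s) i ⟩
    load q σ i + δ (σ s) i (q k)    ≡⟨ cong (λ w → load q σ i + δ (σ s) i w) qk≡qs ⟩
    load q σ i + δ (σ s) i (q s)    ∎)
    where
    open ≡-Reasoning
    σ′ = σ [ k ]≔ σ s
    σ″ = σ′ [ s ]≔ σ k
    σ′s≡σs : σ′ s ≡ σ s
    σ′s≡σs = updateAt-minimal s k σ s≢k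

  feasible-resp : ∀ {N} → Feasible {n} {m} N Respects _≗_
  feasible-resp σ≗τ fσ i = subst (_≤ _) (load-cong (const 1) σ≗τ i) (fσ i)

  feasible? : ∀ N → Decidable (Feasible {n} {m} N)
  feasible? N σ = all? (λ i → jobsOn σ i ≤? N)

  earlyWork-cong : ∀ p d {σ τ : Assignment n m} → σ ≗ τ → earlyWork p d σ ≡ earlyWork p d τ
  earlyWork-cong p d σ≗τ = cong List.sum (map-cong (λ i → cong (d ⊓_) (load-cong p σ≗τ i)) (allFin m))

  earlyWork-∑ : ∀ p d (σ : Assignment n m) → earlyWork p d σ ≡ ∑[ i < m ] (d ⊓ load p σ i)
  earlyWork-∑ p d σ = sum-allFin (λ i → d ⊓ load p σ i)

  lateWork-∑ : ∀ p d (σ : Assignment n m) → lateWork p d σ ≡ ∑[ i < m ] (load p σ i ∸ d)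
  lateWork-∑ p d σ = sum-allFin (λ i → load p σ i ∸ d)

  earlyWork≤m*d : ∀ p d (σ : Assignment n m) → earlyWork p d σ ≤ m * d
  earlyWork≤m*d p d σ = begin
    earlyWork p d σ             ≡⟨ earlyWork-∑ p d σ ⟩
    ∑[ i < m ] (d ⊓ load p σ i) ≤⟨ sum-mono-≤ (λ i → m⊓n≤m d (load p σ i)) ⟩
    ∑[ i < m ] d                ≡⟨ sum-const m d ⟩
    m * d                       ∎
    where open ≤-Reasoning

  earlyWork+lateWork : ∀ p d (σ : Assignment n m) → earlyWork p d σ + lateWork p d σ ≡ ∑[ j < n ] p j
  earlyWork+lateWork p d σ = begin
    earlyWork p d σ + lateWork p d σ  ≡⟨ cong₂ _+_ (earlyWork-∑ p d σ) (lateWork-∑ p d σ) ⟩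
    sum early + sum late              ≡⟨ ∑-distrib-+ early late ⟨
    ∑[ i < m ] (early i + late i)     ≡⟨ sum-cong-≗ (λ i → m⊓n+n∸m≡n d (load p σ i)) ⟩
    ∑[ i < m ] load p σ i             ≡⟨ ∑-load p σ ⟩
    ∑[ j < n ] p j                    ∎
    where
    open ≡-Reasoning
    early late : Fin m → ℕ
    early i = d ⊓ load p σ i
    late  i = load p σ i ∸ d

  lateWork-antitone : ∀ p d (σ τ : Assignment n m) → earlyWork p d τ ≤ earlyWork p d σ →
                      lateWork p d σ ≤ lateWork p d τ
  lateWork-antitone p d σ τ Xτ≤Xσ = +-cancelˡ-≤ (earlyWork p d σ) _ _ (begin
    earlyWork p d σ + lateWork p d σ  ≡⟨ trans (earlyWork+lateWork p d σ) (sym (earlyWork+lateWork p d τ)) ⟩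
    earlyWork p d τ + lateWork p d τ  ≤⟨ +-monoˡ-≤ _ Xτ≤Xσ ⟩
    earlyWork p d σ + lateWork p d τ  ∎)
    where open ≤-Reasoning

load-∷ : ∀ {n m} (q : Fin (suc n) → ℕ) a (σ : Assignment n m) i →
         load q (a Vector.∷ σ) i ≡ δ a i (q zero) + load (q ∘ suc) σ i
load-∷ q a σ i = trans (load-∑ q (a Vector.∷ σ) i) (cong (δ a i (q zero) +_) (sym (load-∑ (q ∘ suc) σ i)))

feasible-exists : ∀ {m} n N → n ≤ m * N → ∃ λ (σ : Assignment n m) → Feasible N σ
feasible-exists zero N _ = (λ ()) , λ _ → z≤n
feasible-exists {m} (suc n) N 1+n≤mN with feasible-exists n N (≤-trans (n≤1+n n) 1+n≤mN)
... | τ , fτ with sum<n*c⇒∃f<c (jobsOn τ) (subst (_< m * N) (sym jobs-total) 1+n≤mN)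
  where
  jobs-total : ∑[ i < m ] jobsOn τ i ≡ n
  jobs-total = trans (∑-load (const 1) τ) (trans (sum-const n 1) (*-identityʳ n))
... | a , room = a Vector.∷ τ , λ i → subst (_≤ N) (sym (load-∷ (const 1) a τ i)) (fits i)
  where
  fits : ∀ i → δ a i 1 + jobsOn τ i ≤ N
  fits i with a ≟ i
  ... | yes refl = room
  ... | no _     = fτ i

module Scheduling {n m : ℕ} (N d : ℕ) (p : Fin n → ℕ) where

  Big : Fin n → Set
  Big j = d ≤ p j

  bigness : Fin n → ℕ
  bigness j = if ⌊ d ≤? p j ⌋ then 1 else 0

  bigness-big : ∀ {j} → Big j → bigness j ≡ 1
  bigness-big {j} big with d ≤? p j
  ... | yes _     = refl
  ... | no ¬big = contradiction big ¬big

  bigness-small : ∀ {j} → ¬ Big j → bigness j ≡ 0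
  bigness-small {j} ¬big with d ≤? p j
  ... | yes big = contradiction big ¬big
  ... | no _    = refl

  bigOn : Assignment n m → Fin m → ℕ
  bigOn = load bigness

  big≤bigOn : ∀ σ {j i} → Big j → σ j ≡ i → 1 ≤ bigOn σ i
  big≤bigOn σ big σj≡i = subst (_≤ _) (bigness-big big) (weight≤load bigness σ σj≡i)

  bigFree⇒≢ : ∀ σ {j i} → bigOn σ i ≡ 0 → Big j → σ j ≢ i
  bigFree⇒≢ σ bigFree big σj≡i = contradiction (subst (1 ≤_) bigFree (big≤bigOn σ big σj≡i)) λ ()

  bigFree-exists : length (bigJobs p d) < m → ∀ σ → ∃ λ i → bigOn σ i ≡ 0
  bigFree-exists |H|<m σ with sum<n*c⇒∃f<c (bigOn σ) (subst₂ _<_ (sym ∑-bigOn) (sym (*-identityʳ m)) |H|<m)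
    where
    ∑-bigOn : ∑[ i < m ] bigOn σ i ≡ length (bigJobs p d)
    ∑-bigOn = trans (∑-load bigness σ)
                    (trans (sym (sum-allFin bigness)) (count-filter (λ j → d ≤? p j) (allFin n)))
  ... | i , bigOn<1 = i , n<1⇒n≡0 bigOn<1

  Separated : Assignment n m → Set
  Separated σ = ∀ j k → Big j → Big k → σ j ≡ σ k → j ≡ k

  record Collision (σ : Assignment n m) : Set where
    constructor collision
    field
      {j k}    : Fin n
      big-j    : Big j
      big-k    : Big k
      same     : σ j ≡ σ k
      distinct : j ≢ k

  separated-or-collision : ∀ σ → Separated σ ⊎ Collision σ
  separated-or-collision σ
    with any? (λ j → any? λ k → (d ≤? p j) ×-dec (d ≤? p k) ×-dec (σ j ≟ σ k) ×-dec ¬? (j ≟ k))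
  ... | yes (j , k , bj , bk , same , j≢k) = inj₂ (collision bj bk same j≢k)
  ... | no none = inj₁ λ j k bj bk same →
    decidable-stable (j ≟ k) λ j≢k → none (j , k , bj , bk , same , j≢k)

  record Relocation (τ : Assignment n m) (j k : Fin n) (i′ : Fin m) : Set where
    field
      τ′          : Assignment n m
      feasible    : Feasible N τ′
      keeps-j     : τ′ j ≡ τ j
      moves-k     : τ′ k ≡ i′
      loads-kept  : ∀ x → τ k ≢ x → i′ ≢ x → load p τ′ x ≡ load p τ x
      bigOn-shift : ∀ x → bigOn τ′ x + δ (τ k) x 1 ≡ bigOn τ x + δ i′ x 1

  module _ {τ : Assignment n m} {j k : Fin n} {i′ : Fin m}
           (fτ : Feasible N τ) (big-k : Big k) (j≢k : j ≢ k) where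

    bigOn-move-k : ∀ a x → bigOn (τ [ k ]≔ a) x + δ (τ k) x 1 ≡ bigOn τ x + δ a x 1
    bigOn-move-k a x = subst (λ w → bigOn (τ [ k ]≔ a) x + δ (τ k) x w ≡ bigOn τ x + δ a x w)
                             (bigness-big big-k) (load-reassign bigness τ k a x)

    move-to-empty : (∀ s → τ s ≢ i′) → Relocation τ j k i′
    move-to-empty empty = record
      { τ′          = τ′
      ; feasible    = feasible
      ; keeps-j     = updateAt-minimal j k τ j≢k
      ; moves-k     = updateAt-updates k τ
      ; loads-kept  = λ x → load-reassign-elsewhere p τ k i′
      ; bigOn-shift = bigOn-move-k i′
      }
      where
      τ′ = τ [ k ]≔ i′
      jobs-shift : ∀ x → jobsOn τ′ x + δ (τ k) x 1 ≡ jobsOn τ x + δ i′ x 1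
      jobs-shift = load-reassign (const 1) τ k i′
      feasible : Feasible N τ′
      feasible x with i′ ≟ x
      ... | yes refl = begin
        jobsOn τ′ i′                    ≤⟨ m≤m+n _ _ ⟩
        jobsOn τ′ i′ + δ (τ k) i′ 1     ≡⟨ jobs-shift i′ ⟩
        jobsOn τ i′ + δ i′ i′ 1         ≡⟨ cong₂ _+_ (load-idle (const 1) τ empty) (δ-≡ refl) ⟩
        1                               ≤⟨ weight≤load (const 1) τ refl ⟩
        jobsOn τ (τ k)                  ≤⟨ fτ (τ k) ⟩
        N                               ∎
        where open ≤-Reasoning
      ... | no i′≢x = begin
        jobsOn τ′ x                     ≤⟨ m≤m+n _ _ ⟩
        jobsOn τ′ x + δ (τ k) x 1       ≡⟨ jobs-shift x ⟩
        jobsOn τ x + δ i′ x 1           ≡⟨ cong (jobsOn τ x +_) (δ-≢ i′≢x) ⟩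
        jobsOn τ x + 0                  ≡⟨ +-identityʳ _ ⟩
        jobsOn τ x                      ≤⟨ fτ x ⟩
        N                               ∎
        where open ≤-Reasoning

    swap-with : ∀ {s} → τ s ≡ i′ → ¬ Big s → Big j → Relocation τ j k i′
    swap-with {s} refl ¬big-s big-j = record
      { τ′          = τ″
      ; feasible    = λ x → subst (_≤ N) (sym (load-swap (const 1) τ refl s≢k x)) (fτ x)
      ; keeps-j     = trans (updateAt-minimal j s τ′ j≢s) (updateAt-minimal j k τ j≢k)
      ; moves-k     = trans (updateAt-minimal k s τ′ (s≢k ∘ sym)) (updateAt-updates k τ)
      ; loads-kept  = λ x τk≢x τs≢x →
          trans (load-reassign-elsewhere p τ′ s (τ k) (τ′s≢ x τs≢x) τk≢x)
                (load-reassign-elsewhere p τ k (τ s) τk≢x τs≢x)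
      ; bigOn-shift = λ x → trans (cong (_+ δ (τ k) x 1) (s-weightless x)) (bigOn-move-k (τ s) x)
      }
      where
      τ′ = τ [ k ]≔ τ s
      τ″ = τ′ [ s ]≔ τ k
      s≢k : s ≢ k
      s≢k refl = ¬big-s big-k
      j≢s : j ≢ s
      j≢s refl = ¬big-s big-j
      τ′s≢ : ∀ x → τ s ≢ x → τ′ s ≢ x
      τ′s≢ x τs≢x = τs≢x ∘ trans (sym (updateAt-minimal s k τ s≢k))
      s-weightless : ∀ x → bigOn τ″ x ≡ bigOn τ′ x
      s-weightless x = load-reassign-weightless bigness τ′ s (τ k) x (bigness-small ¬big-s)

  relocate : ∀ {τ j k i′} → Feasible N τ → Big j → Big k → j ≢ k → bigOn τ i′ ≡ 0 →
             Relocation τ j k i′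
  relocate {τ} {i′ = i′} fτ big-j big-k j≢k bigFree with any? (λ s → τ s ≟ i′)
  ... | no none           = move-to-empty fτ big-k j≢k (λ s τs≡i′ → none (s , τs≡i′))
  ... | yes (s , τs≡i′) = swap-with fτ big-k j≢k τs≡i′ ¬big-s big-j
    where
    ¬big-s : ¬ Big s
    ¬big-s big-s = bigFree⇒≢ τ bigFree big-s τs≡i′

  relocation-improves : ∀ {τ j k i′} → Big j → Big k → τ j ≡ τ k → bigOn τ i′ ≡ 0 →
                        (r : Relocation τ j k i′) → let open Relocation r in
                        earlyWork p d τ ≤ earlyWork p d τ′ × excess (bigOn τ′) < excess (bigOn τ)
  relocation-improves {τ} {j} {k} {i′} big-j big-k τj≡τk bigFree r =
    subst₂ _≤_ (sym (earlyWork-∑ p d τ)) (sym (earlyWork-∑ p d τ′)) (sum-mono-≤ early) ,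
    excess-shift< {f = bigOn τ} {g = bigOn τ′}
                  (bigFree⇒≢ τ bigFree big-k) bigFree (big≤bigOn τ′ big-j τ′j≡τk) bigOn-shift
    where
    open Relocation r
    τ′j≡τk : τ′ j ≡ τ k
    τ′j≡τk = trans keeps-j τj≡τk
    early : ∀ x → d ⊓ load p τ x ≤ d ⊓ load p τ′ x
    early x with τ k ≟ x | i′ ≟ x
    ... | yes refl | _        = m≤o⇒m⊓n≤m⊓o (≤-trans big-j (weight≤load p τ′ τ′j≡τk))
    ... | no _     | yes refl = m≤o⇒m⊓n≤m⊓o (≤-trans big-k (weight≤load p τ′ moves-k))
    ... | no τk≢x  | no i′≢x  = ≤-reflexive (cong (d ⊓_) (sym (loads-kept x τk≢x i′≢x)))

  separate : length (bigJobs p d) < m → ∀ τ → Feasible N τ → Acc _<_ (excess (bigOn τ)) →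
             ∃ λ σ → Feasible N σ × Separated σ × earlyWork p d τ ≤ earlyWork p d σ
  separate |H|<m τ fτ (acc smaller) with separated-or-collision τ
  ... | inj₁ sep = τ , fτ , sep , ≤-refl
  ... | inj₂ (collision big-j big-k same j≢k) =
    let i′ , bigFree = bigFree-exists |H|<m τ
        r = relocate fτ big-j big-k j≢k bigFree
        X≤ , excess< = relocation-improves big-j big-k same bigFree r
        σ , fσ , sep , X≤′ = separate |H|<m (Relocation.τ′ r) (Relocation.feasible r) (smaller excess<)
    in σ , fσ , sep , ≤-trans X≤ X≤′

proposition2 : (m n N d : ℕ) (p : Fin n → ℕ) →
    (∀ j → 0 < p j) → n ≤ m * N →
    suc (length (bigJobs p d)) ≤ m →
    Σ (Assignment n m) λ σ →
      Feasible N σ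
      × (∀ (τ : Assignment n m) → Feasible N τ →
           earlyWork p d τ ≤ earlyWork p d σ × lateWork p d σ ≤ lateWork p d τ)
      × (∀ j k → d ≤ p j → d ≤ p k → σ j ≡ σ k → j ≡ k)
proposition2 m n N d p _ n≤mN |H|<m
  with maximiser feasible-resp (feasible? N) (earlyWork p d) (earlyWork-cong p d) (m * d)
                 (λ σ _ → earlyWork≤m*d p d σ) (feasible-exists n N n≤mN)
... | σ* , feasible-σ* , σ*-optimal
  with Scheduling.separate N d p |H|<m σ* feasible-σ* (<-wellFounded _)
... | σ , feasible-σ , separated-σ , X-σ*≤X-σ = σ , feasible-σ , optimal , separated-σ
  where
  optimal : ∀ τ → Feasible N τ → earlyWork p d τ ≤ earlyWork p d σ × lateWork p d σ ≤ lateWork p d τ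
  optimal τ fτ = X-τ≤X-σ , lateWork-antitone p d σ τ X-τ≤X-σ
    where
    X-τ≤X-σ = ≤-trans (σ*-optimal τ fτ) X-σ*≤X-σ
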